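{- Fix an address $i\in\{0,1\}^t$ and $d\in\{0,\dots,t\}$. Let $D=\sum_{b:\,\mathrm{dist}(b,i)=d}n_b\ge1$, where $n_b$ is the number of elements in bucket $b$. Then for every address $b$ at Hamming distance $d$ from $i$, the Hamming-Distance-Sampler returns $b$ with probability $n_b/D$. It runs in time $O(t)$.
   Context: A single hash table has buckets addressed by $\{0,1\}^t$, with $n_b$ elements in bucket $b$. For an address $a$ and $s,\alpha\in\{0,\dots,t\}$, let $M_a[s,\alpha]$ be the total number of elements in buckets whose address is at Hamming distance $s$ from $a$ and agrees with $a$ in the first $\alpha$ coordinates. These matrices are given as input. Let $e_r\in\{0,1\}^t$ ($r=0,\dots,t-1$) have a single $1$ in coordinate $r+1$, and let $\oplus$ be coordinatewise XOR. Hamming-Distance-Sampler$(i,d)$: 1. Set $\mathrm{MASK}=0^t$ and $g=0$. 2. For $r=0,1,\dots,t-1$, if $g<d$: - let $i'=i\oplus\mathrm{MASK}$ and $i''=i'\oplus e_r$; - set $p_r=\dfrac{M_{i''}[d-g-1,r+1]}{M_{i''}[d-g-1,r+1]+M_{i'}[d-g,r+1]}$; - with probability $p_r$, set $\mathrm{MASK}\leftarrow\mathrm{MASK}\oplus e_r$ and $g\leftarrow g+1$. 3. Return $i\oplus\mathrm{MASK}$. Running time assumes unit-cost arithmetic and constant-time biased coin flips. -}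

module Defs where

open import Data.Bool using (Bool; true; false; _∧_; if_then_else_; _xor_)
open import Data.Nat using (ℕ; zero; suc; _+_; _*_; _∸_; _≡ᵇ_; _<ᵇ_)
open import Data.Fin using (Fin; toℕ)
open import Data.Vec using (Vec; []; _∷_)
open import Data.List using (List; []; _∷_; _++_; map; concatMap; foldr; allFin)
open import Data.Nat.ListAction using (sum)
open import Data.Product using (_×_; _,_; proj₁; proj₂)
open import Data.Integer using (+_)
open import Data.Rational using (ℚ; _/_; 0ℚ; 1ℚ) renaming (_+_ to _+ℚ_; _*_ to _*ℚ_; _-_ to _-ℚ_)
open import Relation.Nullary using (does)
open import Data.Vec.Properties using (≡-dec)
import Data.Bool.Properties as BP

Addr : ℕ → Set
Addr t = Vec Bool t

allAddr : (t : ℕ) → List (Addr t)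
allAddr zero    = [] ∷ []
allAddr (suc t) = map (false ∷_) (allAddr t) ++ map (true ∷_) (allAddr t)

dist : ∀ {t} → Addr t → Addr t → ℕ
dist []       []       = 0
dist (x ∷ xs) (y ∷ ys) = (if x xor y then 1 else 0) + dist xs ys

agreeFirst : ∀ {t} → ℕ → Addr t → Addr t → Bool
agreeFirst zero    _        _        = true
agreeFirst (suc α) []       []       = true
agreeFirst (suc α) (x ∷ xs) (y ∷ ys) = does (x BP.≟ y) ∧ agreeFirst α xs ys

_⊕_ : ∀ {t} → Addr t → Addr t → Addr t
[]       ⊕ []       = []
(x ∷ xs) ⊕ (y ∷ ys) = (x xor y) ∷ (xs ⊕ ys)

-- e_r : single 1 in coordinate r+1 (i.e. 0-indexed position r)
e : ∀ {t} → Fin t → Addr t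
e {suc t} Fin.zero    = true ∷ Data.Vec.replicate t false
e {suc t} (Fin.suc r) = false ∷ e r

zeroAddr : ∀ t → Addr t
zeroAddr t = Data.Vec.replicate t false

M : ∀ {t} → (Addr t → ℕ) → Addr t → ℕ → ℕ → ℕ
M {t} n a s α =
  sum (map (λ b → if (dist b a ≡ᵇ s) ∧ agreeFirst α b a then n b else 0) (allAddr t))

D : ∀ {t} → (Addr t → ℕ) → Addr t → ℕ → ℕ
D {t} n i d = sum (map (λ b → if dist b i ≡ᵇ d then n b else 0) (allAddr t))

-- Rationals: a / b, with the convention a / 0 = 0 (only used for the
-- coin bias; such coins are only reached with probability 0)

frac : ℕ → ℕ → ℚ
frac a zero    = 0ℚ
frac a (suc k) = (+ a) / suc k

-- Finite probability distributions with a unit-cost counter.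
-- An outcome is (probability weight , (cost , value)).

Dist : Set → Set
Dist A = List (ℚ × (ℕ × A))

ret : ∀ {A} → A → Dist A
ret x = (1ℚ , (0 , x)) ∷ []

_>>=_ : ∀ {A B} → Dist A → (A → Dist B) → Dist B
m >>= f = concatMap (λ { (p , (c , x)) → map (λ { (q , (c' , y)) → (p *ℚ q , (c + c' , y)) }) (f x) }) m

tick : ℕ → Dist Bool
tick k = (1ℚ , (k , true)) ∷ []

coin : ℚ → Dist Bool
coin p = (p , (1 , true)) ∷ (1ℚ -ℚ p , (1 , false)) ∷ []

probOf : ∀ {t} → Dist (Addr t) → Addr t → ℚ
probOf []                  b = 0ℚ
probOf ((p , (_ , x)) ∷ m) b = (if does (≡-dec BP._≟_ x b) then p else 0ℚ) +ℚ probOf m b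

costs : ∀ {A} → Dist A → List ℕ
costs = map (λ o → proj₁ (proj₂ o))

-- one iteration r of step 2, acting on the state (MASK , g)
-- unit costs: the test g < d (1), two XORs (2), two matrix lookups (2),
-- one addition and one division (2), coin flip (1, inside coin),
-- and the two updates (2)
sampleStep : ∀ {t} → (Addr t → ℕ) → Addr t → ℕ → Fin t →
             Addr t × ℕ → Dist (Addr t × ℕ)
sampleStep {t} n i d r (mask , g) =
  tick 1 >>= λ _ →
  if g <ᵇ d
  then (let i'  = i ⊕ mask
            i'' = i' ⊕ e r
            a   = M n i'' (d ∸ g ∸ 1) (suc (toℕ r))
            b   = M n i'  (d ∸ g)     (suc (toℕ r))
        in tick 6 >>= λ _ →
           coin (frac a (a + b)) >>= λ flip →
           tick 2 >>= λ _ →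
           if flip then ret (mask ⊕ e r , suc g) else ret (mask , g))
  else ret (mask , g)

sampleLoop : ∀ {t} → (Addr t → ℕ) → Addr t → ℕ → List (Fin t) →
             Addr t × ℕ → Dist (Addr t × ℕ)
sampleLoop n i d []       st = ret st
sampleLoop n i d (r ∷ rs) st = sampleStep n i d r st >>= sampleLoop n i d rs

-- the full algorithm: initialise (2 unit ops), loop, return i ⊕ MASK (1 op)
sampler : ∀ {t} → (Addr t → ℕ) → Addr t → ℕ → Dist (Addr t)
sampler {t} n i d =
  tick 2 >>= λ _ →
  sampleLoop n i d (allFin t) (zeroAddr t , 0) >>= λ { (mask , g) →
  tick 1 >>= λ _ → ret (i ⊕ mask) }

-- Let a state (MASK, g) be reached before coordinate k, and put a = i ⊕ MASK, s = d - g.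
-- By induction on the remaining coordinates, the sampler then outputs b with probability
-- n_b / M_a[s, k] when b lies at distance s from a and agrees with a in the first k
-- coordinates, and with probability 0 otherwise. The induction step rests on
-- M_a[s+1, r] = M_{a ⊕ e_r}[s, r+1] + M_a[s+1, r+1] (a bucket either differs from a in
-- coordinate r or not), which makes p_r exactly the conditional probability of flipping
-- coordinate r; once s = 0 the sum M_a[0, k] no longer depends on k. For k = 0 the claim is
-- n_b / D. Each round charges a constant number of unit operations, whence the O(t) bound.

module Submission where

open import Defs
open import Algebra.Properties.CommutativeSemigroup using (interchange)
open import Data.Bool using (Bool; true; false; _∧_; if_then_else_)
import Data.Bool.Properties as BoolP
open import Data.Empty using (⊥-elim)
open import Data.Fin using (Fin; toℕ)
import Data.Fin as Fin
open import Data.Integer using (+_)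
import Data.Integer as ℤ
import Data.Integer.Properties as ℤP
open import Data.List using (List; []; _∷_; _++_; map; length; allFin; tabulate)
open import Data.List.Properties using (map-++; map-∘; map-cong; length-tabulate)
open import Data.List.Relation.Unary.All using (All; []; _∷_) renaming (map to All-map)
open import Data.List.Relation.Unary.All.Properties using (++⁺)
open import Data.Nat using (ℕ; zero; suc; _+_; _*_; _∸_; _≤_; _<ᵇ_; _≡ᵇ_; z≤n; s≤s)
open import Data.Nat.Coprimality using (1-coprimeTo)
import Data.Nat.Coprimality as Coprime
open import Data.Nat.ListAction using (sum)
open import Data.Nat.ListAction.Properties using (sum-++)
open import Data.Nat.Properties
  using ( +-identityʳ; +-suc; +-comm; +-assoc; +-commutativeSemigroup; *-suc; *-identityˡ
        ; m+n≡0⇒m≡0; m+n≡0⇒n≡0; ≡⇒≡ᵇ; ≤-refl; ≤-trans; ≤-reflexive; +-mono-≤; +-monoʳ-≤ )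
open import Data.Product using (Σ; _×_; _,_; proj₁; proj₂)
open import Data.Rational using (ℚ; mkℚ; 0ℚ; 1ℚ; 1/_)
  renaming (_+_ to _+ℚ_; _*_ to _*ℚ_; _-_ to _-ℚ_)
import Data.Rational.Properties as ℚP
open import Data.Rational.Solver using (module +-*-Solver)
import Data.Rational.Unnormalised as ℚᵘ
import Data.Rational.Unnormalised.Properties as ℚᵘP
open import Data.Vec using ([]; _∷_)
open import Data.Vec.Properties using (≡-dec; ∷-injectiveʳ)
open import Function using (_∘_)
open import Relation.Binary.PropositionalEquality
open import Relation.Nullary using (does; yes; no; ¬_)

⊕-identityʳ : ∀ {t} (a : Addr t) → a ⊕ zeroAddr t ≡ a
⊕-identityʳ []      = refl
⊕-identityʳ (x ∷ a) = cong₂ _∷_ (BoolP.xor-identityʳ x) (⊕-identityʳ a)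

⊕-assoc : ∀ {t} (a b c : Addr t) → (a ⊕ b) ⊕ c ≡ a ⊕ (b ⊕ c)
⊕-assoc []      []      []      = refl
⊕-assoc (x ∷ a) (y ∷ b) (z ∷ c) = cong₂ _∷_ (BoolP.xor-assoc x y z) (⊕-assoc a b c)

dist≡ᵇ0⇒≡ : ∀ {t} (b a : Addr t) → (dist b a ≡ᵇ 0) ≡ true → b ≡ a
dist≡ᵇ0⇒≡ []          []          _ = refl
dist≡ᵇ0⇒≡ (false ∷ b) (false ∷ a) h = cong (false ∷_) (dist≡ᵇ0⇒≡ b a h)
dist≡ᵇ0⇒≡ (true ∷ b)  (true ∷ a)  h = cong (true ∷_) (dist≡ᵇ0⇒≡ b a h)

agreeFirst-refl : ∀ {t} α (a : Addr t) → agreeFirst α a a ≡ true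
agreeFirst-refl zero    a           = refl
agreeFirst-refl (suc α) []          = refl
agreeFirst-refl (suc α) (false ∷ a) = agreeFirst-refl α a
agreeFirst-refl (suc α) (true ∷ a)  = agreeFirst-refl α a

agreeFirst-all⇒≡ : ∀ {t} (b a : Addr t) → agreeFirst t b a ≡ true → b ≡ a
agreeFirst-all⇒≡ []          []          _ = refl
agreeFirst-all⇒≡ (false ∷ b) (false ∷ a) h = cong (false ∷_) (agreeFirst-all⇒≡ b a h)
agreeFirst-all⇒≡ (true ∷ b)  (true ∷ a)  h = cong (true ∷_) (agreeFirst-all⇒≡ b a h)

onShell : ∀ {t} → Addr t → ℕ → ℕ → Addr t → Bool
onShell a s α b = (dist b a ≡ᵇ s) ∧ agreeFirst α b a

M-term : ∀ {t} → (Addr t → ℕ) → Addr t → ℕ → ℕ → Addr t → ℕ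
M-term n a s α b = if onShell a s α b then n b else 0

onShell-radius-zero : ∀ {t} (a : Addr t) α b → onShell a 0 α b ≡ onShell a 0 (suc α) b
onShell-radius-zero a α b with dist b a ≡ᵇ 0 in eq
... | false = refl
... | true rewrite dist≡ᵇ0⇒≡ b a eq | agreeFirst-refl α a | agreeFirst-refl (suc α) a = refl

onShell-full-prefix : ∀ {t} (a : Addr t) s b → ¬ b ≡ a → onShell a s t b ≡ false
onShell-full-prefix {t} a s b b≢a with agreeFirst t b a in eq
... | true  = ⊥-elim (b≢a (agreeFirst-all⇒≡ b a eq))
... | false = BoolP.∧-zeroʳ (dist b a ≡ᵇ s)

M-term-split : ∀ {t} n (a : Addr t) (r : Fin t) s b →
  M-term n a (suc s) (toℕ r) b ≡ M-term n (a ⊕ e r) s (suc (toℕ r)) b + M-term n a (suc s) (suc (toℕ r)) b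
M-term-split n (false ∷ a) Fin.zero s (false ∷ b)
  rewrite ⊕-identityʳ a | BoolP.∧-zeroʳ (suc (dist b a) ≡ᵇ s) | BoolP.∧-identityʳ (dist b a ≡ᵇ suc s) = refl
M-term-split n (true ∷ a)  Fin.zero s (true ∷ b)
  rewrite ⊕-identityʳ a | BoolP.∧-zeroʳ (suc (dist b a) ≡ᵇ s) | BoolP.∧-identityʳ (dist b a ≡ᵇ suc s) = refl
M-term-split n (true ∷ a)  Fin.zero s (false ∷ b)
  rewrite ⊕-identityʳ a | BoolP.∧-zeroʳ (suc (dist b a) ≡ᵇ suc s) | BoolP.∧-identityʳ (dist b a ≡ᵇ s) = sym (+-identityʳ _)
M-term-split n (false ∷ a) Fin.zero s (true ∷ b)
  rewrite ⊕-identityʳ a | BoolP.∧-zeroʳ (suc (dist b a) ≡ᵇ suc s) | BoolP.∧-identityʳ (dist b a ≡ᵇ s) = sym (+-identityʳ _)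
M-term-split n (false ∷ a) (Fin.suc r) s (false ∷ b) = M-term-split (n ∘ (false ∷_)) a r s b
M-term-split n (true ∷ a)  (Fin.suc r) s (true ∷ b)  = M-term-split (n ∘ (true ∷_)) a r s b
M-term-split n (true ∷ a)  (Fin.suc r) s (false ∷ b)
  rewrite BoolP.∧-zeroʳ (dist b a ≡ᵇ s) | BoolP.∧-zeroʳ (suc (dist b (a ⊕ e r)) ≡ᵇ s) = refl
M-term-split n (false ∷ a) (Fin.suc r) s (true ∷ b)
  rewrite BoolP.∧-zeroʳ (dist b a ≡ᵇ s) | BoolP.∧-zeroʳ (suc (dist b (a ⊕ e r)) ≡ᵇ s) = refl

sum-map-+ : ∀ {A : Set} (f g : A → ℕ) xs → sum (map (λ x → f x + g x) xs) ≡ sum (map f xs) + sum (map g xs)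
sum-map-+ f g []       = refl
sum-map-+ f g (x ∷ xs) =
  trans (cong (_+_ (f x + g x)) (sum-map-+ f g xs)) (interchange +-commutativeSemigroup (f x) (g x) _ _)

sum-allAddr-suc : ∀ {t} (f : Addr (suc t) → ℕ) →
  sum (map f (allAddr (suc t))) ≡ sum (map (f ∘ (false ∷_)) (allAddr t)) + sum (map (f ∘ (true ∷_)) (allAddr t))
sum-allAddr-suc {t} f = begin
  sum (map f (map (false ∷_) (allAddr t) ++ map (true ∷_) (allAddr t)))
    ≡⟨ cong sum (map-++ f (map (false ∷_) (allAddr t)) _) ⟩
  sum (map f (map (false ∷_) (allAddr t)) ++ map f (map (true ∷_) (allAddr t)))
    ≡⟨ sum-++ (map f (map (false ∷_) (allAddr t))) _ ⟩
  sum (map f (map (false ∷_) (allAddr t))) + sum (map f (map (true ∷_) (allAddr t)))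
    ≡⟨ sym (cong₂ (λ u v → sum u + sum v) (map-∘ (allAddr t)) (map-∘ (allAddr t))) ⟩
  sum (map (f ∘ (false ∷_)) (allAddr t)) + sum (map (f ∘ (true ∷_)) (allAddr t)) ∎
  where open ≡-Reasoning

sum-allAddr-single : ∀ {t} (f : Addr t → ℕ) a → (∀ b → ¬ b ≡ a → f b ≡ 0) → sum (map f (allAddr t)) ≡ f a
sum-allAddr-single f []      _    = +-identityʳ (f [])
sum-allAddr-single f (y ∷ a) off = trans (sum-allAddr-suc f) (halves y off)
  where
  restrict : ∀ {y} x → (∀ b → ¬ b ≡ y ∷ a → f b ≡ 0) → sum (map (f ∘ (x ∷_)) (allAddr _)) ≡ f (x ∷ a)
  restrict x off′ = sum-allAddr-single (f ∘ (x ∷_)) a (λ b b≢a → off′ (x ∷ b) (b≢a ∘ ∷-injectiveʳ))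
  halves : ∀ y → (∀ b → ¬ b ≡ y ∷ a → f b ≡ 0) →
    sum (map (f ∘ (false ∷_)) (allAddr _)) + sum (map (f ∘ (true ∷_)) (allAddr _)) ≡ f (y ∷ a)
  halves false off′ rewrite restrict false off′ | restrict true off′ | off′ (true ∷ a) (λ ()) = +-identityʳ _
  halves true  off′ rewrite restrict false off′ | restrict true off′ | off′ (false ∷ a) (λ ()) = refl

M-split : ∀ {t} n (a : Addr t) (r : Fin t) s →
  M n a (suc s) (toℕ r) ≡ M n (a ⊕ e r) s (suc (toℕ r)) + M n a (suc s) (suc (toℕ r))
M-split {t} n a r s = trans (cong sum (map-cong (M-term-split n a r s) (allAddr t)))
  (sum-map-+ (M-term n (a ⊕ e r) s (suc (toℕ r))) (M-term n a (suc s) (suc (toℕ r))) (allAddr t))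

M-radius-zero : ∀ {t} n (a : Addr t) α → M n a 0 α ≡ M n a 0 (suc α)
M-radius-zero {t} n a α =
  cong sum (map-cong (λ b → cong (if_then n b else 0) (onShell-radius-zero a α b)) (allAddr t))

M-full-prefix : ∀ {t} n (a : Addr t) s → M n a s t ≡ M-term n a s t a
M-full-prefix {t} n a s = sum-allAddr-single (M-term n a s t) a
  (λ b b≢a → cong (if_then n b else 0) (onShell-full-prefix a s b b≢a))

M-empty-prefix : ∀ {t} n (i : Addr t) d → M n i d 0 ≡ D n i d
M-empty-prefix {t} n i d =
  cong sum (map-cong (λ b → cong (if_then n b else 0) (BoolP.∧-identityʳ (dist b i ≡ᵇ d))) (allAddr t))

expect : ∀ {A : Set} → Dist A → (A → ℚ) → ℚ
expect []                  h = 0ℚ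
expect ((p , (_ , x)) ∷ m) h = p *ℚ h x +ℚ expect m h

expect-++ : ∀ {A : Set} (m m′ : Dist A) h → expect (m ++ m′) h ≡ expect m h +ℚ expect m′ h
expect-++ []                  m′ h = sym (ℚP.+-identityˡ _)
expect-++ ((p , (_ , x)) ∷ m) m′ h =
  trans (cong (p *ℚ h x +ℚ_) (expect-++ m m′ h)) (sym (ℚP.+-assoc (p *ℚ h x) _ _))

expect-scale : ∀ {A : Set} p c (m : Dist A) h →
  expect (map (λ o → p *ℚ proj₁ o , c + proj₁ (proj₂ o) , proj₂ (proj₂ o)) m) h ≡ p *ℚ expect m h
expect-scale p c []                  h = sym (ℚP.*-zeroʳ p)
expect-scale p c ((q , (_ , x)) ∷ m) h = begin
  p *ℚ q *ℚ h x +ℚ expect (map _ m) h ≡⟨ cong₂ _+ℚ_ (ℚP.*-assoc p q (h x)) (expect-scale p c m h) ⟩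
  p *ℚ (q *ℚ h x) +ℚ p *ℚ expect m h  ≡⟨ sym (ℚP.*-distribˡ-+ p _ _) ⟩
  p *ℚ (q *ℚ h x +ℚ expect m h)       ∎
  where open ≡-Reasoning

expect-bind : ∀ {A B : Set} (m : Dist A) (f : A → Dist B) h → expect (m >>= f) h ≡ expect m (λ x → expect (f x) h)
expect-bind []                  f h = refl
expect-bind ((p , (c , x)) ∷ m) f h =
  trans (expect-++ (map _ (f x)) (m >>= f) h) (cong₂ _+ℚ_ (expect-scale p c (f x) h) (expect-bind m f h))

expect-cong : ∀ {A : Set} (m : Dist A) {h h′ : A → ℚ} → (∀ x → h x ≡ h′ x) → expect m h ≡ expect m h′
expect-cong []                  eq = refl
expect-cong ((p , (_ , x)) ∷ m) eq = cong₂ _+ℚ_ (cong (p *ℚ_) (eq x)) (expect-cong m eq)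

expect-ret : ∀ {A : Set} (x : A) h → expect (ret x) h ≡ h x
expect-ret x h = trans (ℚP.+-identityʳ _) (ℚP.*-identityˡ _)

expect-tick : ∀ {B : Set} k (f : Bool → Dist B) h → expect (tick k >>= f) h ≡ expect (f true) h
expect-tick k f h = trans (expect-bind (tick k) f h) (expect-ret true (λ x → expect (f x) h))

expect-coin : ∀ {B : Set} p (f : Bool → Dist B) h →
  expect (coin p >>= f) h ≡ p *ℚ expect (f true) h +ℚ (1ℚ -ℚ p) *ℚ expect (f false) h
expect-coin p f h = trans (expect-bind (coin p) f h) (cong (p *ℚ expect (f true) h +ℚ_) (ℚP.+-identityʳ _))

indicator : ∀ {t} → Addr t → Addr t → ℚ
indicator b x = if does (≡-dec BoolP._≟_ x b) then 1ℚ else 0ℚ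

probOf≡expect-indicator : ∀ {t} (m : Dist (Addr t)) b → probOf m b ≡ expect m (indicator b)
probOf≡expect-indicator []                  b = refl
probOf≡expect-indicator ((p , (_ , x)) ∷ m) b with does (≡-dec BoolP._≟_ x b)
... | true  = cong₂ _+ℚ_ (sym (ℚP.*-identityʳ p)) (probOf≡expect-indicator m b)
... | false = cong₂ _+ℚ_ (sym (ℚP.*-zeroʳ p)) (probOf≡expect-indicator m b)

fromℕ : ℕ → ℚ
fromℕ m = mkℚ (+ m) 0 (Coprime.sym (1-coprimeTo m))

fromℕ-+ : ∀ a b → fromℕ (a + b) ≡ fromℕ a +ℚ fromℕ b
fromℕ-+ a b = ℚP.toℚᵘ-injective (ℚᵘP.≃-trans (ℚᵘ.*≡* eq) (ℚᵘP.≃-sym (ℚP.toℚᵘ-homo-+ (fromℕ a) (fromℕ b))))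
  where
  eq : + (a + b) ℤ.* + 1 ≡ (+ a ℤ.* + 1 ℤ.+ + b ℤ.* + 1) ℤ.* + 1
  eq rewrite ℤP.*-identityʳ (+ (a + b)) | ℤP.*-identityʳ (+ a) | ℤP.*-identityʳ (+ b)
           | ℤP.*-identityʳ (+ a ℤ.+ + b) = ℤP.pos-+ a b

fromℕ-*-frac : ∀ k a → fromℕ (suc k) *ℚ frac a (suc k) ≡ fromℕ a
fromℕ-*-frac k a = ℚP.toℚᵘ-injective (ℚᵘP.≃-trans (ℚP.toℚᵘ-homo-* (fromℕ (suc k)) (frac a (suc k)))
  (ℚᵘP.≃-trans (ℚᵘP.*-congˡ {ℚᵘ.mkℚᵘ (+ suc k) 0} (ℚP.toℚᵘ-fromℚᵘ (ℚᵘ.mkℚᵘ (+ a) k))) (ℚᵘ.*≡* eq)))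
  where
  eq : (+ suc k ℤ.* + a) ℤ.* + 1 ≡ + a ℤ.* + (1 * suc k)
  eq rewrite ℤP.*-identityʳ (+ suc k ℤ.* + a) | *-identityˡ (suc k) = ℤP.*-comm (+ suc k) (+ a)

frac-unique : ∀ m a x → 1 ≤ m → fromℕ m *ℚ x ≡ fromℕ a → x ≡ frac a m
frac-unique (suc k) a x _ h = begin
  x                  ≡⟨ cancel x ⟩
  1/ u *ℚ (u *ℚ x)   ≡⟨ cong (1/ u *ℚ_) (trans h (sym (fromℕ-*-frac k a))) ⟩
  1/ u *ℚ (u *ℚ q)   ≡⟨ sym (cancel q) ⟩
  q                  ∎
  where
  open ≡-Reasoning
  u = fromℕ (suc k)
  q = frac a (suc k)
  cancel : ∀ y → y ≡ 1/ u *ℚ (u *ℚ y)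
  cancel y = sym (trans (sym (ℚP.*-assoc (1/ u) u y))
                        (trans (cong (_*ℚ y) (ℚP.*-inverseˡ u)) (ℚP.*-identityˡ y)))

-- When A + B = 0 the bias is the junk value frac 0 0 = 0, but then both sides vanish.
coin-average : ∀ A B G₁ G₀ X₁ X₀ → fromℕ A *ℚ G₁ ≡ fromℕ X₁ → fromℕ B *ℚ G₀ ≡ fromℕ X₀ →
  fromℕ (A + B) *ℚ (frac A (A + B) *ℚ G₁ +ℚ (1ℚ -ℚ frac A (A + B)) *ℚ G₀) ≡ fromℕ (X₁ + X₀)
coin-average A B G₁ G₀ X₁ X₀ h₁ h₀ with A + B in A+B≡
... | zero rewrite m+n≡0⇒m≡0 A A+B≡ | m+n≡0⇒n≡0 A A+B≡ = begin
  fromℕ 0 *ℚ (frac 0 0 *ℚ G₁ +ℚ (1ℚ -ℚ frac 0 0) *ℚ G₀)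
                                         ≡⟨ ℚP.*-zeroˡ (frac 0 0 *ℚ G₁ +ℚ (1ℚ -ℚ frac 0 0) *ℚ G₀) ⟩
  0ℚ                                     ≡⟨ sym (cong₂ _+ℚ_ (ℚP.*-zeroˡ G₁) (ℚP.*-zeroˡ G₀)) ⟩
  fromℕ 0 *ℚ G₁ +ℚ fromℕ 0 *ℚ G₀          ≡⟨ cong₂ _+ℚ_ h₁ h₀ ⟩
  fromℕ X₁ +ℚ fromℕ X₀                    ≡⟨ sym (fromℕ-+ X₁ X₀) ⟩
  fromℕ (X₁ + X₀)                        ∎
  where open ≡-Reasoning
... | suc w = begin
  u *ℚ (q *ℚ G₁ +ℚ (1ℚ -ℚ q) *ℚ G₀)
    ≡⟨ solve 4 (λ u q G₁ G₀ → u :* (q :* G₁ :+ (con 1ℚ :- q) :* G₀) := (u :* q) :* G₁ :+ (u :- u :* q) :* G₀)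
         refl u q G₁ G₀ ⟩
  (u *ℚ q) *ℚ G₁ +ℚ (u -ℚ u *ℚ q) *ℚ G₀
    ≡⟨ cong₂ (λ y z → y *ℚ G₁ +ℚ (z -ℚ y) *ℚ G₀) (fromℕ-*-frac w A) (trans (cong fromℕ (sym A+B≡)) (fromℕ-+ A B)) ⟩
  fromℕ A *ℚ G₁ +ℚ (fromℕ A +ℚ fromℕ B -ℚ fromℕ A) *ℚ G₀
    ≡⟨ cong (λ z → fromℕ A *ℚ G₁ +ℚ z *ℚ G₀) (solve 2 (λ a b → a :+ b :- a := b) refl (fromℕ A) (fromℕ B)) ⟩
  fromℕ A *ℚ G₁ +ℚ fromℕ B *ℚ G₀
    ≡⟨ cong₂ _+ℚ_ h₁ h₀ ⟩
  fromℕ X₁ +ℚ fromℕ X₀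
    ≡⟨ sym (fromℕ-+ X₁ X₀) ⟩
  fromℕ (X₁ + X₀) ∎
  where
  open ≡-Reasoning
  open +-*-Solver
  u = fromℕ (suc w)
  q = frac A (suc w)

-- G = M-term n a s α b / M n a s α, multiplied out so that M n a s α = 0 needs no separate case.
IsHitProbability : ∀ {t} → (Addr t → ℕ) → Addr t → ℕ → ℕ → Addr t → ℚ → Set
IsHitProbability n a s α b G = fromℕ (M n a s α) *ℚ G ≡ fromℕ (M-term n a s α b)

flipBias : ∀ {t} → (Addr t → ℕ) → Addr t → ℕ → Fin t → ℚ
flipBias n a s r = frac (M n (a ⊕ e r) (s ∸ 1) (suc (toℕ r)))
                        (M n (a ⊕ e r) (s ∸ 1) (suc (toℕ r)) + M n a s (suc (toℕ r)))

isHitProbability-flip : ∀ {t} n (a a′ b : Addr t) r s s′ G₁ G₀ → a′ ≡ a ⊕ e r → s ≡ suc s′ →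
  IsHitProbability n a′ s′ (suc (toℕ r)) b G₁ → IsHitProbability n a s (suc (toℕ r)) b G₀ →
  IsHitProbability n a s (toℕ r) b (flipBias n a s r *ℚ G₁ +ℚ (1ℚ -ℚ flipBias n a s r) *ℚ G₀)
isHitProbability-flip n a .(a ⊕ e r) b r .(suc s′) s′ G₁ G₀ refl refl h₁ h₀
  rewrite M-split n a r s′ | M-term-split n a r s′ b = coin-average _ _ G₁ G₀ _ _ h₁ h₀

isHitProbability-idle : ∀ {t} n (a b : Addr t) s α G → s ≡ 0 →
  IsHitProbability n a s (suc α) b G → IsHitProbability n a s α b G
isHitProbability-idle n a b .0 α G refl h rewrite M-radius-zero n a α | onShell-radius-zero a α b = h

isHitProbability-full-prefix : ∀ {t} n (a b : Addr t) s → IsHitProbability n a s t b (indicator b a)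
isHitProbability-full-prefix {t} n a b s with ≡-dec BoolP._≟_ a b
... | yes refl rewrite M-full-prefix n a s = ℚP.*-identityʳ _
... | no a≢b rewrite onShell-full-prefix a s b (a≢b ∘ sym) = ℚP.*-zeroʳ (fromℕ (M n a s t))

isHitProbability-empty-prefix : ∀ {t} n (i b : Addr t) d G → 1 ≤ D n i d → dist b i ≡ d →
  IsHitProbability n i d 0 b G → G ≡ frac (n b) (D n i d)
isHitProbability-empty-prefix n i b d G 1≤D b∈shell h = frac-unique (D n i d) (n b) G 1≤D (begin
  fromℕ (D n i d) *ℚ G      ≡⟨ cong (λ m → fromℕ m *ℚ G) (sym (M-empty-prefix n i d)) ⟩
  fromℕ (M n i d 0) *ℚ G    ≡⟨ h ⟩
  fromℕ (M-term n i d 0 b)  ≡⟨ cong fromℕ (M-term-zero-prefix b∈shell) ⟩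
  fromℕ (n b)               ∎)
  where
  open ≡-Reasoning
  M-term-zero-prefix : dist b i ≡ d → M-term n i d 0 b ≡ n b
  M-term-zero-prefix refl with dist b i ≡ᵇ dist b i | ≡⇒≡ᵇ (dist b i) (dist b i) refl
  ... | true  | _  = refl
  ... | false | ()

module SampleStep {t} (n : Addr t → ℕ) (i : Addr t) (d : ℕ) (r : Fin t) (mask : Addr t) (g : ℕ) where

  update : Bool → Dist (Addr t × ℕ)
  update flip = tick 2 >>= λ _ → if flip then ret (mask ⊕ e r , suc g) else ret (mask , g)

  flipRound : Dist (Addr t × ℕ)
  flipRound = tick 6 >>= λ _ → coin (flipBias n (i ⊕ mask) (d ∸ g) r) >>= update

  guarded : Dist (Addr t × ℕ)
  guarded = if g <ᵇ d then flipRound else ret (mask , g)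

  expect-sampleStep-< : ∀ G → (g <ᵇ d) ≡ true →
    expect (sampleStep n i d r (mask , g)) G ≡
      flipBias n (i ⊕ mask) (d ∸ g) r *ℚ G (mask ⊕ e r , suc g) +ℚ (1ℚ -ℚ flipBias n (i ⊕ mask) (d ∸ g) r) *ℚ G (mask , g)
  expect-sampleStep-< G g<d = begin
    expect (sampleStep n i d r (mask , g)) G  ≡⟨ expect-tick 1 (λ _ → guarded) G ⟩
    expect guarded G                          ≡⟨ cong (λ c → expect (if c then flipRound else ret (mask , g)) G) g<d ⟩
    expect flipRound G                        ≡⟨ expect-tick 6 (λ _ → coin p >>= update) G ⟩
    expect (coin p >>= update) G              ≡⟨ expect-coin p update G ⟩
    p *ℚ expect (update true) G +ℚ (1ℚ -ℚ p) *ℚ expect (update false) G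
      ≡⟨ cong₂ (λ x y → p *ℚ x +ℚ (1ℚ -ℚ p) *ℚ y) (expect-update true) (expect-update false) ⟩
    p *ℚ G (mask ⊕ e r , suc g) +ℚ (1ℚ -ℚ p) *ℚ G (mask , g) ∎
    where
    open ≡-Reasoning
    p = flipBias n (i ⊕ mask) (d ∸ g) r
    expect-update : ∀ flip → expect (update flip) G ≡ G (if flip then (mask ⊕ e r , suc g) else (mask , g))
    expect-update true  = trans (expect-tick 2 (λ _ → ret (mask ⊕ e r , suc g)) G) (expect-ret _ G)
    expect-update false = trans (expect-tick 2 (λ _ → ret (mask , g)) G) (expect-ret _ G)

  expect-sampleStep-≮ : ∀ G → (g <ᵇ d) ≡ false → expect (sampleStep n i d r (mask , g)) G ≡ G (mask , g)
  expect-sampleStep-≮ G g≮d = begin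
    expect (sampleStep n i d r (mask , g)) G  ≡⟨ expect-tick 1 (λ _ → guarded) G ⟩
    expect guarded G                          ≡⟨ cong (λ c → expect (if c then flipRound else ret (mask , g)) G) g≮d ⟩
    expect (ret (mask , g)) G                 ≡⟨ expect-ret (mask , g) G ⟩
    G (mask , g)                              ∎
    where open ≡-Reasoning

data Ascending {t : ℕ} : ℕ → List (Fin t) → Set where
  stop : ∀ {k} → k ≡ t → Ascending k []
  next : ∀ {k r rs} → toℕ r ≡ k → Ascending (suc k) rs → Ascending k (r ∷ rs)

tabulate-ascending : ∀ {t} l k (f : Fin l → Fin t) → (∀ j → toℕ (f j) ≡ k + toℕ j) → k + l ≡ t →
  Ascending k (tabulate f)
tabulate-ascending zero    k f f≡ k+l≡t = stop (trans (sym (+-identityʳ k)) k+l≡t)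
tabulate-ascending (suc l) k f f≡ k+l≡t = next (trans (f≡ Fin.zero) (+-identityʳ k))
  (tabulate-ascending l (suc k) (f ∘ Fin.suc) (λ j → trans (f≡ (Fin.suc j)) (+-suc k (toℕ j)))
                      (trans (sym (+-suc k l)) k+l≡t))

allFin-ascending : ∀ t → Ascending 0 (allFin t)
allFin-ascending t = tabulate-ascending t 0 (λ j → j) (λ _ → refl) refl

∸-<ᵇ : ∀ g d → (g <ᵇ d) ≡ true → d ∸ g ≡ suc (d ∸ suc g)
∸-<ᵇ zero    (suc d) _   = refl
∸-<ᵇ (suc g) (suc d) g<d = ∸-<ᵇ g d g<d

∸-≮ᵇ : ∀ g d → (g <ᵇ d) ≡ false → d ∸ g ≡ 0
∸-≮ᵇ zero    zero    _   = refl
∸-≮ᵇ (suc g) zero    _   = refl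
∸-≮ᵇ (suc g) (suc d) g≮d = ∸-≮ᵇ g d g≮d

hits : ∀ {t} → Addr t → Addr t → Addr t × ℕ → ℚ
hits i b st = indicator b (i ⊕ proj₁ st)

sampleLoop-hits : ∀ {t} n (i b : Addr t) d {k rs} → Ascending k rs → ∀ mask g →
  IsHitProbability n (i ⊕ mask) (d ∸ g) k b (expect (sampleLoop n i d rs (mask , g)) (hits i b))
sampleLoop-hits {t} n i b d (stop refl) mask g =
  trans (cong (fromℕ (M n (i ⊕ mask) (d ∸ g) t) *ℚ_) (expect-ret (mask , g) (hits i b)))
        (isHitProbability-full-prefix n (i ⊕ mask) b (d ∸ g))
sampleLoop-hits {t} n i b d (next {r = r} {rs} refl asc) mask g =
  trans (cong (fromℕ (M n (i ⊕ mask) (d ∸ g) (toℕ r)) *ℚ_)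
              (expect-bind (sampleStep n i d r (mask , g)) (sampleLoop n i d rs) (hits i b)))
        (by-guard (g <ᵇ d) refl)
  where
  open SampleStep n i d r mask g
  rest : Addr t × ℕ → ℚ
  rest st = expect (sampleLoop n i d rs st) (hits i b)
  by-guard : ∀ c → (g <ᵇ d) ≡ c →
    IsHitProbability n (i ⊕ mask) (d ∸ g) (toℕ r) b (expect (sampleStep n i d r (mask , g)) rest)
  by-guard true g<d =
    trans (cong (fromℕ (M n (i ⊕ mask) (d ∸ g) (toℕ r)) *ℚ_) (expect-sampleStep-< rest g<d))
          (isHitProbability-flip n (i ⊕ mask) (i ⊕ (mask ⊕ e r)) b r (d ∸ g) (d ∸ suc g)
             (rest (mask ⊕ e r , suc g)) (rest (mask , g)) (sym (⊕-assoc i mask (e r))) (∸-<ᵇ g d g<d)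
             (sampleLoop-hits n i b d asc (mask ⊕ e r) (suc g)) (sampleLoop-hits n i b d asc mask g))
  by-guard false g≮d =
    trans (cong (fromℕ (M n (i ⊕ mask) (d ∸ g) (toℕ r)) *ℚ_) (expect-sampleStep-≮ rest g≮d))
          (isHitProbability-idle n (i ⊕ mask) b (d ∸ g) (toℕ r) (rest (mask , g)) (∸-≮ᵇ g d g≮d)
             (sampleLoop-hits n i b d asc mask g))

module SamplerParts {t} (n : Addr t → ℕ) (i : Addr t) (d : ℕ) where

  loop : Dist (Addr t × ℕ)
  loop = sampleLoop n i d (allFin t) (zeroAddr t , 0)

  output : Addr t × ℕ → Dist (Addr t)
  output st = tick 1 >>= λ _ → ret (i ⊕ proj₁ st)

  expect-sampler : ∀ h → expect (sampler n i d) h ≡ expect loop (λ st → h (i ⊕ proj₁ st))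
  expect-sampler h = begin
    expect (sampler n i d) h                ≡⟨ expect-tick 2 (λ _ → loop >>= output) h ⟩
    expect (loop >>= output) h              ≡⟨ expect-bind loop output h ⟩
    expect loop (λ st → expect (output st) h)
      ≡⟨ expect-cong loop (λ st → trans (expect-tick 1 (λ _ → ret (i ⊕ proj₁ st)) h) (expect-ret _ h)) ⟩
    expect loop (λ st → h (i ⊕ proj₁ st))   ∎
    where open ≡-Reasoning

sampler-exact : ∀ {t} n (i : Addr t) d → 1 ≤ D n i d → ∀ b → dist b i ≡ d →
  probOf (sampler n i d) b ≡ frac (n b) (D n i d)
sampler-exact {t} n i d 1≤D b b∈shell = begin
  probOf (sampler n i d) b                ≡⟨ probOf≡expect-indicator (sampler n i d) b ⟩
  expect (sampler n i d) (indicator b)    ≡⟨ expect-sampler (indicator b) ⟩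
  expect loop (hits i b)                  ≡⟨ isHitProbability-empty-prefix n i b d _ 1≤D b∈shell
                                               (subst (λ a → IsHitProbability n a d 0 b (expect loop (hits i b)))
                                                      (⊕-identityʳ i) (sampleLoop-hits n i b d (allFin-ascending t) (zeroAddr t) 0)) ⟩
  frac (n b) (D n i d)                    ∎
  where
  open ≡-Reasoning
  open SamplerParts n i d

CostAtMost : ∀ {A : Set} → ℕ → Dist A → Set
CostAtMost c m = All (_≤ c) (costs m)

costAtMost-ret : ∀ {A : Set} {c} (x : A) → CostAtMost c (ret x)
costAtMost-ret x = z≤n ∷ []

costAtMost-tick : ∀ k → CostAtMost k (tick k)
costAtMost-tick k = ≤-refl ∷ []

costAtMost-coin : ∀ p → CostAtMost 1 (coin p)
costAtMost-coin p = ≤-refl ∷ ≤-refl ∷ []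

costAtMost-mono : ∀ {A : Set} {c c′} {m : Dist A} → c ≤ c′ → CostAtMost c m → CostAtMost c′ m
costAtMost-mono c≤c′ = All-map (λ k≤c → ≤-trans k≤c c≤c′)

costAtMost-if : ∀ {A : Set} {c} b {m m′ : Dist A} → CostAtMost c m → CostAtMost c m′ →
  CostAtMost c (if b then m else m′)
costAtMost-if true  cm _   = cm
costAtMost-if false _  cm′ = cm′

costAtMost-++ : ∀ {A : Set} {c} (m m′ : Dist A) → CostAtMost c m → CostAtMost c m′ → CostAtMost c (m ++ m′)
costAtMost-++ m m′ cm cm′ = subst (All _) (sym (map-++ _ m m′)) (++⁺ cm cm′)

costAtMost-bind : ∀ {A B : Set} {c₁ c₂} (m : Dist A) (f : A → Dist B) →
  CostAtMost c₁ m → (∀ x → CostAtMost c₂ (f x)) → CostAtMost (c₁ + c₂) (m >>= f)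
costAtMost-bind []                  f _          _  = []
costAtMost-bind ((p , (c , x)) ∷ m) f (c≤ ∷ cm) cf =
  costAtMost-++ (map _ (f x)) (m >>= f) (shift (f x) (cf x)) (costAtMost-bind m f cm cf)
  where
  shift : ∀ m′ → CostAtMost _ m′ → CostAtMost _ (map (λ o → p *ℚ proj₁ o , c + proj₁ (proj₂ o) , proj₂ (proj₂ o)) m′)
  shift []       _          = []
  shift (_ ∷ m′) (c′≤ ∷ cm′) = +-mono-≤ c≤ c′≤ ∷ shift m′ cm′

sampleStep-cost : ∀ {t} n (i : Addr t) d r mask g → CostAtMost 10 (sampleStep n i d r (mask , g))
sampleStep-cost n i d r mask g =
  costAtMost-bind (tick 1) (λ _ → guarded) (costAtMost-tick 1) (λ _ →
    costAtMost-if (g <ᵇ d) flipRound-cost (costAtMost-ret (mask , g)))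
  where
  open SampleStep n i d r mask g
  p = flipBias n (i ⊕ mask) (d ∸ g) r
  flipRound-cost : CostAtMost 9 flipRound
  flipRound-cost =
    costAtMost-bind (tick 6) (λ _ → coin p >>= update) (costAtMost-tick 6) (λ _ →
      costAtMost-bind (coin p) update (costAtMost-coin p) (λ flip →
        costAtMost-bind (tick 2) (λ _ → if flip then ret (mask ⊕ e r , suc g) else ret (mask , g)) (costAtMost-tick 2) (λ _ →
          costAtMost-if flip (costAtMost-ret (mask ⊕ e r , suc g)) (costAtMost-ret (mask , g)))))

sampleLoop-cost : ∀ {t} n (i : Addr t) d rs st → CostAtMost (10 * length rs) (sampleLoop n i d rs st)
sampleLoop-cost n i d []       st       = costAtMost-ret st
sampleLoop-cost n i d (r ∷ rs) (mask , g) =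
  subst (λ c → CostAtMost c (sampleLoop n i d (r ∷ rs) (mask , g))) (sym (*-suc 10 (length rs)))
    (costAtMost-bind (sampleStep n i d r (mask , g)) (sampleLoop n i d rs)
      (sampleStep-cost n i d r mask g) (sampleLoop-cost n i d rs))

sampler-cost : ∀ {t} n (i : Addr t) d → CostAtMost (10 * t + 10) (sampler n i d)
sampler-cost {t} n i d = costAtMost-mono bound
  (costAtMost-bind (tick 2) (λ _ → loop >>= output) (costAtMost-tick 2) (λ _ →
    costAtMost-bind loop output (sampleLoop-cost n i d (allFin t) (zeroAddr t , 0)) (λ st →
      costAtMost-bind (tick 1) (λ _ → ret (i ⊕ proj₁ st)) (costAtMost-tick 1) (λ _ → costAtMost-ret (i ⊕ proj₁ st)))))
  where
  open SamplerParts n i d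
  bound : 2 + (10 * length (allFin t) + (1 + 0)) ≤ 10 * t + 10
  bound rewrite length-tabulate {n = t} (λ j → j) | +-identityʳ 1 =
    ≤-trans (≤-reflexive (trans (+-comm 2 (10 * t + 1)) (+-assoc (10 * t) 1 2))) (+-monoʳ-≤ (10 * t) (s≤s (s≤s (s≤s z≤n))))

lemma7 : Σ ℕ λ c →
           (t : ℕ) (n : Addr t → ℕ) (i : Addr t) (d : ℕ) → d ≤ t →
           ((1 ≤ D n i d) → (b : Addr t) → dist b i ≡ d →
              probOf (sampler n i d) b ≡ frac (n b) (D n i d))
           × All (λ k → k ≤ c * t + c) (costs (sampler n i d))
lemma7 = 10 , λ t n i d _ → sampler-exact n i d , sampler-cost n i d
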